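{- Let $W$ be a wing with point of return $k$ and companion vertex $k'$. Then $T=\mu_{k'}(W)$ is a tip with point of return $k'$ (and companion vertex $k$), and $|T_1|>|W_1|$.
   Context: A quiver is a finite directed multigraph with vertex set $Q_0$ and arrow set $Q_1$, no loops and no 2-cycles; $|Q_1|$ is the total number of arrows; $q_{ij}$ is the number of arrows $i\to j$ if positive and minus the number of arrows $j\to i$ otherwise (likewise $w_{ij},t_{ij}$). Mutation $\mu_v$: $q'_{ab}=-q_{ab}$ if $v\in\{a,b\}$, else $q'_{ab}=q_{ab}+\max(q_{av},0)\max(q_{vb},0)-\max(q_{bv},0)\max(q_{va},0)$. $Q\setminus V$ is the full subquiver on vertices not in $V$. $Q^+(v)=\{j:q_{vj}>0\}$, $Q^-(v)=\{j:q_{jv}>0\}$, $Q^k_{k'}=(Q^+(k)\cap Q^-(k'))\cup(Q^+(k')\cap Q^-(k))$. Abundant: at least two arrows between every pair of distinct vertices; acyclic: no directed cycle. A fork is an abundant, non-acyclic quiver $F$ with a vertex $r$ (point of return) such that for all $i\in F^-(r)$, $j\in F^+(r)$: $f_{ji}>f_{ir}$ and $f_{ji}>f_{rj}$, and the full subquivers on $F^-(r)$, $F^+(r)$ are acyclic. Triangle condition for a quiver $X$ and vertices $k,k'$ with $|x_{kk'}|=1$: whenever a vertex $i$ with $a,b>0$ gives either ($a$ arrows $k\to i$, $b$ arrows $i\to k'$, one arrow $k'\to k$) or ($a$ arrows $i\to k$, $b$ arrows $k'\to i$, one arrow $k\to k'$), then $b\ge a+2$. A wing with point of return $k$ and companion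 vertex $k'$ is a quiver $W$ with $|w_{kk'}|<2$, $W^k_{k'}=W_0\setminus\{k,k'\}$, $W\setminus\{k'\}$ a fork with point of return $k$, $W\setminus\{k\}$ abundant acyclic, and satisfying the triangle condition. A tip with point of return $k'$ and companion vertex $k$ is a quiver $T$ with $|t_{kk'}|<2$ such that $T\setminus\{k\}$ is a fork with point of return $k'$; $T^k_{k'}=\emptyset$ if $t_{k'k}=0$, $T^k_{k'}=T^-(k')$ if $t_{k'k}=1$, and $T^k_{k'}=T^+(k')$ if $t_{kk'}=1$; $T\setminus\{k'\}$ is a fork with point of return $k$ if $t_{kk'}=0$ and abundant acyclic otherwise, with $k$ a source of $T\setminus\{k'\}$ if $t_{k'k}=1$ and a sink of $T\setminus\{k'\}$ if $t_{kk'}=1$; and $T$ satisfies the triangle condition. -}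

module Defs where

open import Data.Nat as ℕ using (ℕ)
open import Data.Integer using (ℤ; +_; -_; _+_; _*_; _⊔_; _<_; _>_; _≤_; ∣_∣)
open import Data.Fin using (Fin)
open import Data.List using (List; map; allFin)
open import Data.Nat.ListAction using (sum)
open import Data.Product using (_×_; Σ)
open import Data.Sum using (_⊎_)
open import Data.Empty using (⊥)
open import Relation.Nullary using (¬_)
open import Relation.Binary.PropositionalEquality using (_≡_; _≢_)
open import Relation.Binary.Construct.Closure.Transitive using (TransClosure)

-- A quiver on vertex set Fin n is encoded by its skew-symmetric exchange
-- matrix q : q i j = #arrows i → j if positive, minus #arrows j → i otherwise.
-- Skew-symmetry encodes "no loops, no 2-cycles".
Mat : ℕ → Set
Mat n = Fin n → Fin n → ℤ

IsQuiver : ∀ {n} → Mat n → Set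
IsQuiver {n} q = ∀ (i j : Fin n) → q i j ≡ - q j i

pos : ℤ → ℤ
pos x = x ⊔ + 0

numArrows : ∀ {n} → Mat n → ℕ
numArrows {n} q = sum (map (λ i → sum (map (λ j → ∣ pos (q i j) ∣) (allFin n))) (allFin n))

open import Relation.Nullary.Decidable using (⌊_⌋)
open import Data.Fin using (_≟_)
open import Data.Bool using (if_then_else_; _∨_)

mutate : ∀ {n} → Fin n → Mat n → Mat n
mutate v q a b =
  if ⌊ v ≟ a ⌋ ∨ ⌊ v ≟ b ⌋
  then - q a b
  else q a b + pos (q a v) * pos (q v b) + - (pos (q b v) * pos (q v a))

-- Vertex subsets (full subquivers are given by a subset of the vertices).
VSet : ℕ → Set₁
VSet n = Fin n → Set

minus : ∀ {n} → Fin n → VSet n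
minus v i = i ≢ v

Out : ∀ {n} → Mat n → Fin n → VSet n
Out q v j = q v j > + 0

In : ∀ {n} → Mat n → Fin n → VSet n
In q v j = q j v > + 0

_∩_ : ∀ {n} → VSet n → VSet n → VSet n
(S ∩ T) i = S i × T i

Qkk' : ∀ {n} → Mat n → Fin n → Fin n → VSet n
Qkk' q k k' i = (Out q k i × In q k' i) ⊎ (Out q k' i × In q k i)

_≐_ : ∀ {n} → VSet n → VSet n → Set
_≐_ {n} S T = ∀ (i : Fin n) → (S i → T i) × (T i → S i)

Arr : ∀ {n} → Mat n → VSet n → Fin n → Fin n → Set
Arr q S i j = S i × S j × (q i j > + 0)

Acyclic : ∀ {n} → Mat n → VSet n → Set
Acyclic {n} q S = ∀ (i : Fin n) → ¬ TransClosure (Arr q S) i i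

Abundant : ∀ {n} → Mat n → VSet n → Set
Abundant {n} q S = ∀ (i j : Fin n) → S i → S j → i ≢ j → 2 ℕ.≤ ∣ q i j ∣

Fork : ∀ {n} → Mat n → VSet n → Fin n → Set
Fork {n} f S r =
  S r
  × Abundant f S
  × ¬ Acyclic f S
  × (∀ (i j : Fin n) → S i → S j → f i r > + 0 → f r j > + 0 →
       (f j i > f i r) × (f j i > f r j))
  × Acyclic f (S ∩ In f r)
  × Acyclic f (S ∩ Out f r)

Source : ∀ {n} → Mat n → VSet n → Fin n → Set
Source {n} q S k = ∀ (j : Fin n) → S j → ¬ (q j k > + 0)

Sink : ∀ {n} → Mat n → VSet n → Fin n → Set
Sink {n} q S k = ∀ (j : Fin n) → S j → ¬ (q k j > + 0)

TriangleCond : ∀ {n} → Mat n → Fin n → Fin n → Set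
TriangleCond {n} x k k' =
  ∀ (i : Fin n) (a b : ℤ) → a > + 0 → b > + 0 →
    ((x k i ≡ a) × (x i k' ≡ b) × (x k' k ≡ + 1))
    ⊎ ((x i k ≡ a) × (x k' i ≡ b) × (x k k' ≡ + 1)) →
    b ≥ a + + 2
  where open import Data.Integer using (_≥_)

Empty : ∀ {n} → VSet n
Empty i = ⊥

Wing : ∀ {n} → Mat n → Fin n → Fin n → Set
Wing {n} w k k' =
  IsQuiver w
  × (∣ w k k' ∣ ℕ.< 2)
  × (Qkk' w k k' ≐ (λ i → (i ≢ k) × (i ≢ k')))
  × Fork w (minus k') k
  × (Abundant w (minus k) × Acyclic w (minus k))
  × TriangleCond w k k'

Tip : ∀ {n} → Mat n → Fin n → Fin n → Set
Tip {n} t k' k =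
  IsQuiver t
  × (∣ t k k' ∣ ℕ.< 2)
  × Fork t (minus k) k'
  × (t k' k ≡ + 0 → Qkk' t k k' ≐ Empty)
  × (t k' k ≡ + 1 → Qkk' t k k' ≐ In t k')
  × (t k k' ≡ + 1 → Qkk' t k k' ≐ Out t k')
  × (t k k' ≡ + 0 → Fork t (minus k') k)
  × (t k k' ≢ + 0 → Abundant t (minus k') × Acyclic t (minus k'))
  × (t k' k ≡ + 1 → Source t (minus k') k)
  × (t k k' ≡ + 1 → Sink t (minus k') k)
  × TriangleCond t k k'

module Submission where

-- Every vertex i ∉ {k, k'} of the wing lies on a path k → i → k' or k' → i → k.
-- Mutation at k' reverses the arrows at k', keeps the arrows inside each of these
-- two classes, and adds w_ak' w_k'b arrows a → b for a of the first and b of the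
-- second kind; a → b was already an arrow of W because W \ {k} is acyclic.  The
-- row of k changes only if w_kk' = ±1, and then the triangle condition makes the
-- new entries large enough for k to become a source (or sink) of T \ {k'}.  For the count, whatever row k
-- loses is outweighed by the arrows gained between one fixed vertex and the other
-- class.

open import Defs
open import Data.Nat as ℕ using (ℕ; zero; suc)
import Data.Nat.Properties as ℕP
open import Data.Integer as ℤ
  using (ℤ; +_; -[1+_]; -_; _+_; _*_; _-_; _≤_; _<_; _>_; ∣_∣; +≤+; -≤+; +<+; -<+; 0ℤ; 1ℤ; -1ℤ)
import Data.Integer.Properties as ℤP
open import Data.Integer.Tactic.RingSolver using (solve-∀)
open import Data.Fin using (Fin; zero; suc; _≟_)
open import Data.Fin.Properties using (any?)
open import Data.List using (map; allFin; tabulate)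
import Data.List.Properties as ListP
import Data.Nat.ListAction as ℕList
open import Data.Product using (_×_; _,_; Σ; proj₁; proj₂)
open import Data.Sum using (_⊎_; inj₁; inj₂)
open import Data.Empty using (⊥-elim)
open import Data.Bool using (true; false; if_then_else_)
open import Function using (_∘_)
open import Relation.Nullary using (¬_; yes; no; Dec; does; ¬?; _×-dec_)
open import Relation.Binary.PropositionalEquality
open import Relation.Binary.Construct.Closure.Transitive using (TransClosure; [_]; _∷_; _++_)
open import Algebra.Properties.CommutativeMonoid.Sum ℤP.+-0-commutativeMonoid
  using (sum; sum-syntax; ∑-distrib-+; ∑-comm; sum-replicate-zero; sum-cong-≗)

private
  variable
    n : ℕ

*-pos : ∀ {p q} → 0ℤ < p → 0ℤ < q → 0ℤ < p * q
*-pos {+ suc _} {+ suc _} _         _         = +<+ (ℕ.s≤s ℕ.z≤n)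
*-pos {+ zero}  {_}       (+<+ ()) _
*-pos {+ suc _} {+ zero}  _         (+<+ ())

≤-+-nonneg : ∀ {x y d} → x ≤ y → 0ℤ ≤ d → x ≤ y + d
≤-+-nonneg {x} x≤y d≥0 = subst (_≤ _) (ℤP.+-identityʳ x) (ℤP.+-mono-≤ x≤y d≥0)

<-+-nonneg : ∀ {x y d} → x < y → 0ℤ ≤ d → x < y + d
<-+-nonneg {x} x<y d≥0 = subst (_< _) (ℤP.+-identityʳ x) (ℤP.+-mono-<-≤ x<y d≥0)

<-+-pos : ∀ {x y z} → 0ℤ < x → y ≤ z → y < x + z
<-+-pos {y = y} x>0 y≤z = subst (_< _) (ℤP.+-identityˡ y) (ℤP.+-mono-<-≤ x>0 y≤z)

2≤∣x∣⇒2≤x : ∀ {x} → 0ℤ < x → 2 ℕ.≤ ∣ x ∣ → + 2 ≤ x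
2≤∣x∣⇒2≤x {+ _} _ h = +≤+ h

2≤x⇒2≤∣x∣ : ∀ {x} → + 2 ≤ x → 2 ℕ.≤ ∣ x ∣
2≤x⇒2≤∣x∣ (+≤+ h) = h

x≤-2⇒2≤∣x∣ : ∀ {x} → x ≤ - + 2 → 2 ℕ.≤ ∣ x ∣
x≤-2⇒2≤∣x∣ {x} h = subst (2 ℕ.≤_) (ℤP.∣-i∣≡∣i∣ x) (2≤x⇒2≤∣x∣ (ℤP.neg-mono-≤ h))

≤-*-pos : ∀ {p q} → 0ℤ < p → 0ℤ ≤ q → q ≤ p * q
≤-*-pos {p} {q} p>0 q≥0 =
  subst (_≤ p * q) (ℤP.*-identityˡ q) (ℤP.*-monoʳ-≤-nonNeg q {{ℤ.nonNegative q≥0}} (ℤP.i<j⇒suc[i]≤j p>0))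

+∣x∣≡-x : ∀ {x} → x ≤ 0ℤ → + ∣ x ∣ ≡ - x
+∣x∣≡-x {x} x≤0 = trans (cong +_ (sym (ℤP.∣-i∣≡∣i∣ x))) (ℤP.0≤i⇒+∣i∣≡i (ℤP.neg-mono-≤ x≤0))

x+2≤y⇒2≤y-x : ∀ {x y} → x + + 2 ≤ y → + 2 ≤ y - x
x+2≤y⇒2≤y-x {x} {y} h = subst (_≤ y - x) (cancel x) (ℤP.+-monoˡ-≤ (- x) h)
  where
  cancel : ∀ x → x + + 2 - x ≡ + 2
  cancel = solve-∀

x+2≤y⇒x-y≤-2 : ∀ {x y} → x + + 2 ≤ y → x - y ≤ - + 2
x+2≤y⇒x-y≤-2 {x} {y} h = subst (_≤ - + 2) (negate x y) (ℤP.neg-mono-≤ (x+2≤y⇒2≤y-x h))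
  where
  negate : ∀ x y → - (y - x) ≡ x - y
  negate = solve-∀

2≤x⇒y-x+2≤y : ∀ {x y} → + 2 ≤ x → y - x + + 2 ≤ y
2≤x⇒y-x+2≤y {x} {y} h = subst (y - x + + 2 ≤_) (cancel x y) (ℤP.+-monoʳ-≤ (y - x) h)
  where
  cancel : ∀ x y → y - x + x ≡ y
  cancel = solve-∀

pq+q-y-y>0 : ∀ {p q y} → + 2 ≤ p → 0ℤ < y → y + + 2 ≤ q → 0ℤ < p * q + (q - y - y)
pq+q-y-y>0 {p} {q} {y} p≥2 y>0 q≥y+2 = begin-strict
  0ℤ                          <⟨ <-+-nonneg y>0 (+≤+ ℕ.z≤n) ⟩
  y + + 6                     ≡⟨ regroup₁ y ⟩
  + 3 * (y + + 2) - + 2 * y   ≤⟨ ℤP.+-monoˡ-≤ (- (+ 2 * y)) (ℤP.*-monoˡ-≤-nonNeg (+ 3) q≥y+2) ⟩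
  + 3 * q - + 2 * y           ≡⟨ regroup₂ q y ⟩
  + 2 * q + (q - y - y)       ≤⟨ ℤP.+-monoˡ-≤ (q - y - y) (ℤP.*-monoʳ-≤-nonNeg q {{ℤ.nonNegative q≥0}} p≥2) ⟩
  p * q + (q - y - y)         ∎
  where
  open ℤP.≤-Reasoning
  q≥0 : 0ℤ ≤ q
  q≥0 = ℤP.≤-trans (≤-+-nonneg (ℤP.<⇒≤ y>0) (+≤+ ℕ.z≤n)) q≥y+2
  regroup₁ : ∀ y → y + + 6 ≡ + 3 * (y + + 2) - + 2 * y
  regroup₁ = solve-∀
  regroup₂ : ∀ q y → + 3 * q - + 2 * y ≡ + 2 * q + (q - y - y)
  regroup₂ = solve-∀

sum-nonneg : (f : Fin n → ℤ) → (∀ i → 0ℤ ≤ f i) → 0ℤ ≤ sum f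
sum-nonneg {zero}  f f≥0 = ℤP.≤-refl
sum-nonneg {suc n} f f≥0 = ℤP.+-mono-≤ (f≥0 zero) (sum-nonneg (f ∘ suc) (f≥0 ∘ suc))

sum-pos : (f : Fin n → ℤ) → (∀ i → 0ℤ ≤ f i) → ∀ p → 0ℤ < f p → 0ℤ < sum f
sum-pos f f≥0 zero    fp>0 = ℤP.+-mono-<-≤ fp>0 (sum-nonneg (f ∘ suc) (f≥0 ∘ suc))
sum-pos f f≥0 (suc p) fp>0 = ℤP.+-mono-≤-< (f≥0 zero) (sum-pos (f ∘ suc) (f≥0 ∘ suc) p fp>0)

indicator : Fin n → ℤ → Fin n → ℤ
indicator p x i = if does (i ≟ p) then x else 0ℤ

indicator-at : (p : Fin n) (x : ℤ) → indicator p x p ≡ x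
indicator-at p x with p ≟ p
... | yes _   = refl
... | no p≢p = ⊥-elim (p≢p refl)

indicator-off : {p i : Fin n} (x : ℤ) → i ≢ p → indicator p x i ≡ 0ℤ
indicator-off {p = p} {i} x i≢p with i ≟ p
... | yes i≡p = ⊥-elim (i≢p i≡p)
... | no _    = refl

sum-indicator : (p : Fin n) (x : ℤ) → sum (indicator p x) ≡ x
sum-indicator {suc n} zero    x = trans (cong (_+_ x) (sum-replicate-zero n)) (ℤP.+-identityʳ x)
sum-indicator {suc n} (suc p) x = trans (ℤP.+-identityˡ _) (sum-indicator p x)

merge : Fin n → Fin n → (Fin n → ℤ) → Fin n → ℤ
merge k v f i = f i + indicator v (f k) i - indicator k (f k) i

indicator-distrib-+ : (p : Fin n) (x y : ℤ) (i : Fin n) →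
                      indicator p (x + y) i ≡ indicator p x i + indicator p y i
indicator-distrib-+ p x y i with does (i ≟ p)
... | true  = refl
... | false = refl

merge-distrib-+ : {k v : Fin n} (f g : Fin n → ℤ) (i : Fin n) →
                  merge k v (λ j → f j + g j) i ≡ merge k v f i + merge k v g i
merge-distrib-+ {k = k} {v} f g i = begin
  f i + g i + indicator v (f k + g k) i - indicator k (f k + g k) i
    ≡⟨ cong₂ (λ x y → f i + g i + x - y) (indicator-distrib-+ v (f k) (g k) i)
                                         (indicator-distrib-+ k (f k) (g k) i) ⟩
  f i + g i + (fᵛ + gᵛ) - (fᵏ + gᵏ)
    ≡⟨ interchange (f i) (g i) fᵛ gᵛ fᵏ gᵏ ⟩
  (f i + fᵛ - fᵏ) + (g i + gᵛ - gᵏ) ∎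
  where
  open ≡-Reasoning
  fᵛ = indicator v (f k) i
  gᵛ = indicator v (g k) i
  fᵏ = indicator k (f k) i
  gᵏ = indicator k (g k) i
  interchange : ∀ a b c d e g → a + b + (c + d) - (e + g) ≡ (a + c - e) + (b + d - g)
  interchange = solve-∀

sum-merge : (k v : Fin n) (f : Fin n → ℤ) → sum (merge k v f) ≡ sum f
sum-merge k v f = begin
  sum (merge k v f)
    ≡⟨ ∑-distrib-+ (λ i → f i + indicator v (f k) i) (λ i → - indicator k (f k) i) ⟩
  sum (λ i → f i + indicator v (f k) i) + sum (λ i → - indicator k (f k) i)
    ≡⟨ cong₂ _+_ (∑-distrib-+ f (indicator v (f k))) (sum-neg (indicator k (f k))) ⟩
  sum f + sum (indicator v (f k)) - sum (indicator k (f k))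
    ≡⟨ cong₂ (λ x y → sum f + x - y) (sum-indicator v (f k)) (sum-indicator k (f k)) ⟩
  sum f + f k - f k
    ≡⟨ add-sub-cancel (sum f) (f k) ⟩
  sum f ∎
  where
  open ≡-Reasoning
  add-sub-cancel : ∀ a b → a + b - b ≡ a
  add-sub-cancel = solve-∀
  sum-neg : ∀ {m} (g : Fin m → ℤ) → sum (λ i → - g i) ≡ - sum g
  sum-neg {zero}  g = refl
  sum-neg {suc m} g = trans (cong (_+_ (- g zero)) (sum-neg (g ∘ suc))) (sym (ℤP.neg-distrib-+ (g zero) _))

module _ {k v : Fin n} (f : Fin n → ℤ) where

  merge-at-source : v ≢ k → merge k v f k ≡ 0ℤ
  merge-at-source v≢k = begin
    f k + indicator v (f k) k - indicator k (f k) k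
      ≡⟨ cong₂ (λ x y → f k + x - y) (indicator-off (f k) (v≢k ∘ sym)) (indicator-at k (f k)) ⟩
    f k + 0ℤ - f k
      ≡⟨ cong (_- f k) (ℤP.+-identityʳ (f k)) ⟩
    f k - f k
      ≡⟨ ℤP.+-inverseʳ (f k) ⟩
    0ℤ ∎
    where open ≡-Reasoning

  merge-at-target : v ≢ k → merge k v f v ≡ f v + f k
  merge-at-target v≢k = begin
    f v + indicator v (f k) v - indicator k (f k) v
      ≡⟨ cong₂ (λ x y → f v + x - y) (indicator-at v (f k)) (indicator-off (f k) v≢k) ⟩
    f v + f k - 0ℤ
      ≡⟨ ℤP.+-identityʳ _ ⟩
    f v + f k ∎
    where open ≡-Reasoning

  merge-elsewhere : ∀ {i} → i ≢ k → i ≢ v → merge k v f i ≡ f i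
  merge-elsewhere {i} i≢k i≢v = begin
    f i + indicator v (f k) i - indicator k (f k) i
      ≡⟨ cong₂ (λ x y → f i + x - y) (indicator-off (f k) i≢v) (indicator-off (f k) i≢k) ⟩
    f i + 0ℤ - 0ℤ
      ≡⟨ trans (ℤP.+-identityʳ _) (ℤP.+-identityʳ (f i)) ⟩
    f i ∎
    where open ≡-Reasoning

  merge-nonneg : v ≢ k → (∀ i → i ≢ k → i ≢ v → 0ℤ ≤ f i) → 0ℤ ≤ f v + f k →
                 ∀ i → 0ℤ ≤ merge k v f i
  merge-nonneg v≢k f≥0 fv+fk≥0 i = by-cases (i ≟ k) (i ≟ v)
    where
    by-cases : Dec (i ≡ k) → Dec (i ≡ v) → 0ℤ ≤ merge k v f i
    by-cases (yes refl) _          = ℤP.≤-reflexive (sym (merge-at-source v≢k))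
    by-cases (no _)     (yes refl) = subst (0ℤ ≤_) (sym (merge-at-target v≢k)) fv+fk≥0
    by-cases (no i≢k)   (no i≢v)   = subst (0ℤ ≤_) (sym (merge-elsewhere i≢k i≢v)) (f≥0 i i≢k i≢v)

∑∑ : (Fin n → Fin n → ℤ) → ℤ
∑∑ {n} s = ∑[ i < n ] ∑[ j < n ] s i j

merge² : Fin n → Fin n → (Fin n → Fin n → ℤ) → Fin n → Fin n → ℤ
merge² k v s i = merge k v (λ j → merge k v (λ i′ → s i′ j) i)

sum-merge² : (k v : Fin n) (s : Fin n → Fin n → ℤ) → ∑∑ (merge² k v s) ≡ ∑∑ s
sum-merge² {n} k v s = begin
  ∑[ i < n ] sum (merge² k v s i)             ≡⟨ sum-cong-≗ (λ i → sum-merge k v (λ j → rows j i)) ⟩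
  ∑[ i < n ] ∑[ j < n ] rows j i              ≡⟨ ∑-comm (λ i j → rows j i) ⟩
  ∑[ j < n ] sum (rows j)                     ≡⟨ sum-cong-≗ (λ j → sum-merge k v (λ i → s i j)) ⟩
  ∑[ j < n ] ∑[ i < n ] s i j                 ≡⟨ ∑-comm (λ j i → s i j) ⟩
  ∑∑ s ∎
  where
  open ≡-Reasoning
  rows : Fin n → Fin n → ℤ
  rows j = merge k v (λ i → s i j)

-- Merging row and column k into row and column v gives a nonnegative array
-- with the same sum and the positive entry s v x + s k x.
∑∑-pos-by-merging : (s : Fin n → Fin n → ℤ) {k v x : Fin n} → v ≢ k → x ≢ k → x ≢ v →
  (∀ i j → s i j ≡ s j i) →
  (∀ i j → i ≢ k → j ≢ k → 0ℤ ≤ s i j) →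
  (∀ j → 0ℤ ≤ s v j + s k j) →
  0ℤ < s v x + s k x →
  0ℤ < ∑∑ s
∑∑-pos-by-merging {n} s {k} {v} {x} v≢k x≢k x≢v s-sym s≥0 dom dom-x =
  subst (0ℤ <_) (sum-merge² k v s)
    (sum-pos _ (λ i → sum-nonneg _ (merged≥0 i)) v
      (sum-pos _ (merged≥0 v) x (subst (0ℤ <_) (sym merged-v-x) dom-x)))
  where
  rows : Fin n → Fin n → ℤ
  rows i j = merge k v (λ i′ → s i′ j) i

  rows≥0 : ∀ i j → j ≢ k → 0ℤ ≤ rows i j
  rows≥0 i j j≢k = merge-nonneg (λ i′ → s i′ j) v≢k (λ i′ i′≢k _ → s≥0 i′ j i′≢k j≢k) (dom j) i

  column-v-plus-k≥0 : ∀ i → 0ℤ ≤ rows i v + rows i k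
  column-v-plus-k≥0 i = subst (0ℤ ≤_) (merge-+ i)
    (merge-nonneg (λ i′ → s i′ v + s i′ k) v≢k
      (λ i′ _ _ → subst₂ (λ a b → 0ℤ ≤ a + b) (s-sym v i′) (s-sym k i′) (dom i′))
      (subst₂ (λ a b → 0ℤ ≤ (s v v + a) + (b + s k k)) (s-sym k v) (s-sym v k)
         (ℤP.+-mono-≤ (dom v) (dom k)))
      i)
    where
    merge-+ : ∀ i → merge k v (λ i′ → s i′ v + s i′ k) i ≡ rows i v + rows i k
    merge-+ = merge-distrib-+ (λ i′ → s i′ v) (λ i′ → s i′ k)

  merged≥0 : ∀ i j → 0ℤ ≤ merge² k v s i j
  merged≥0 i = merge-nonneg (rows i) v≢k (λ j j≢k _ → rows≥0 i j j≢k) (column-v-plus-k≥0 i)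

  merged-v-x : merge² k v s v x ≡ s v x + s k x
  merged-v-x = trans (merge-elsewhere (rows v) x≢k x≢v) (merge-at-target (λ i → s i x) v≢k)

∑∑-distrib-+ : (s u : Fin n → Fin n → ℤ) → ∑∑ (λ i j → s i j + u i j) ≡ ∑∑ s + ∑∑ u
∑∑-distrib-+ {n} s u = trans (sum-cong-≗ (λ i → ∑-distrib-+ (s i) (u i))) (∑-distrib-+ (sum ∘ s) (sum ∘ u))

-- Counting arrows

pos-nonneg : ∀ x → 0ℤ ≤ pos x
pos-nonneg (+ _)    = +≤+ ℕ.z≤n
pos-nonneg -[1+ _ ] = +≤+ ℕ.z≤n

pos-pos : ∀ {x} → 0ℤ < x → pos x ≡ x
pos-pos {+ m} _ = cong +_ (ℕP.⊔-identityʳ m)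

pos-nonpos : ∀ {x} → x ≤ 0ℤ → pos x ≡ 0ℤ
pos-nonpos { -[1+ _ ]} _        = refl
pos-nonpos {+ zero}    _        = refl
pos-nonpos {+ suc _}   (+≤+ ())

pos+pos-neg : ∀ x → pos x + pos (- x) ≡ + ∣ x ∣
pos+pos-neg (+ zero)  = refl
pos+pos-neg (+ suc m) = ℤP.+-identityʳ (+ suc m)
pos+pos-neg -[1+ m ]  = refl

+-sum-allFin : (g : Fin n → ℕ) → + ℕList.sum (map g (allFin n)) ≡ ∑[ i < n ] (+ g i)
+-sum-allFin g = trans (cong (λ xs → + ℕList.sum xs) (ListP.map-tabulate (λ i → i) g)) (+-sum-tabulate g)
  where
  +-sum-tabulate : ∀ {m} (h : Fin m → ℕ) → + ℕList.sum (tabulate h) ≡ ∑[ i < m ] (+ h i)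
  +-sum-tabulate {zero}  h = refl
  +-sum-tabulate {suc m} h = cong (_+_ (+ h zero)) (+-sum-tabulate (h ∘ suc))

numArrows-as-∑∑ : (q : Mat n) → + numArrows q ≡ ∑∑ (λ i j → pos (q i j))
numArrows-as-∑∑ {n} q =
  trans (+-sum-allFin (λ i → ℕList.sum (map (λ j → ∣ pos (q i j) ∣) (allFin n))))
        (sum-cong-≗ λ i → trans (+-sum-allFin (λ j → ∣ pos (q i j) ∣))
                                (sum-cong-≗ λ j → ℤP.0≤i⇒+∣i∣≡i (pos-nonneg (q i j))))

numArrows-twice : {q : Mat n} → IsQuiver q → + numArrows q + + numArrows q ≡ ∑∑ (λ i j → + ∣ q i j ∣)
numArrows-twice {n} {q} quiver = begin
  + numArrows q + + numArrows q
    ≡⟨ cong₂ _+_ (numArrows-as-∑∑ q) (numArrows-as-∑∑ q) ⟩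
  ∑∑ (λ i j → pos (q i j)) + ∑∑ (λ i j → pos (q i j))
    ≡⟨ cong (_+_ (∑∑ (λ i j → pos (q i j)))) (∑-comm (λ i j → pos (q i j))) ⟩
  ∑∑ (λ i j → pos (q i j)) + ∑∑ (λ i j → pos (q j i))
    ≡⟨ ∑∑-distrib-+ (λ i j → pos (q i j)) (λ i j → pos (q j i)) ⟨
  ∑∑ (λ i j → pos (q i j) + pos (q j i))
    ≡⟨ sum-cong-≗ (λ i → sum-cong-≗ λ j →
         trans (cong (λ x → pos (q i j) + pos x) (quiver j i)) (pos+pos-neg (q i j))) ⟩
  ∑∑ (λ i j → + ∣ q i j ∣) ∎
  where open ≡-Reasoning

numArrows-< : {q r : Mat n} → IsQuiver q → IsQuiver r →
              0ℤ < ∑∑ (λ i j → + ∣ r i j ∣ - + ∣ q i j ∣) → numArrows q ℕ.< numArrows r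
numArrows-< {n} {q} {r} q-quiver r-quiver Δ>0 = half-< (ℤP.drop‿+<+ (begin-strict
  + numArrows q + + numArrows q        ≡⟨ numArrows-twice q-quiver ⟩
  ∑∑ ∣q∣                               ≡⟨ ℤP.+-identityʳ _ ⟨
  ∑∑ ∣q∣ + 0ℤ                          <⟨ ℤP.+-monoʳ-< (∑∑ ∣q∣) Δ>0 ⟩
  ∑∑ ∣q∣ + ∑∑ Δ                        ≡⟨ ∑∑-distrib-+ ∣q∣ Δ ⟨
  ∑∑ (λ i j → ∣q∣ i j + Δ i j)         ≡⟨ sum-cong-≗ (λ i → sum-cong-≗ λ j → add-sub (∣q∣ i j) (∣r∣ i j)) ⟩
  ∑∑ ∣r∣                               ≡⟨ numArrows-twice r-quiver ⟨
  + numArrows r + + numArrows r        ∎))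
  where
  open ℤP.≤-Reasoning
  ∣q∣ ∣r∣ Δ : Fin n → Fin n → ℤ
  ∣q∣ i j = + ∣ q i j ∣
  ∣r∣ i j = + ∣ r i j ∣
  Δ i j = ∣r∣ i j - ∣q∣ i j
  add-sub : ∀ a b → a + (b - a) ≡ b
  add-sub = solve-∀
  half-< : ∀ {a b} → a ℕ.+ a ℕ.< b ℕ.+ b → a ℕ.< b
  half-< {a} {b} a+a<b+b with a ℕP.<? b
  ... | yes a<b = a<b
  ... | no a≮b  = ⊥-elim (ℕP.<⇒≱ a+a<b+b (ℕP.+-mono-≤ (ℕP.≮⇒≥ a≮b) (ℕP.≮⇒≥ a≮b)))

-- Paths and cycles

module _ {A : Set} where

  concatMap⁺ : {R S : A → A → Set} → (∀ {x y} → R x y → TransClosure S x y) →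
               ∀ {x y} → TransClosure R x y → TransClosure S x y
  concatMap⁺ f [ e ]    = f e
  concatMap⁺ f (e ∷ es) = f e ++ concatMap⁺ f es

  Within : (A → Set) → (A → A → Set) → A → A → Set
  Within P R x y = P x × P y × R x y

  module _ {P : A → Set} {R : A → A → Set} where

    restrict-by-targets : (∀ {x y} → R x y → P y) →
                          ∀ {x y} → P x → TransClosure R x y → TransClosure (Within P R) x y
    restrict-by-targets p px [ e ]    = [ px , p e , e ]
    restrict-by-targets p px (e ∷ es) = (px , p e , e) ∷ restrict-by-targets p (p e) es

    restrict-by-sources : (∀ {x y} → R x y → P x) →
                          ∀ {x y} → P y → TransClosure R x y → TransClosure (Within P R) x y
    restrict-by-sources p py [ e ]    = [ p e , py , e ]
    restrict-by-sources p py (e ∷ es) = (p e , source es′ , e) ∷ es′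
      where
      es′ = restrict-by-sources p py es
      source : ∀ {x y} → TransClosure (Within P R) x y → P x
      source [ e ]   = proj₁ e
      source (e ∷ _) = proj₁ e

    last-target : (∀ {x y} → R x y → P y) → ∀ {x y} → TransClosure R x y → P y
    last-target p [ e ]    = p e
    last-target p (_ ∷ es) = last-target p es

    first-source : (∀ {x y} → R x y → P x) → ∀ {x y} → TransClosure R x y → P x
    first-source p [ e ]   = p e
    first-source p (e ∷ _) = p e

module _ {q : Mat n} where

  acyclic-by-paths : {r : Mat n} {S U : VSet n} →
                     (∀ {i j} → Arr q S i j → TransClosure (Arr r U) i j) →
                     Acyclic r U → Acyclic q S
  acyclic-by-paths f r-acyclic i cycle = r-acyclic i (concatMap⁺ f cycle)

  acyclic-by-arrows : {r : Mat n} {S U : VSet n} →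
                      (∀ {i j} → Arr q S i j → Arr r U i j) → Acyclic r U → Acyclic q S
  acyclic-by-arrows f = acyclic-by-paths ([_] ∘ f)

  acyclic-if-targets-in : {S P : VSet n} → (∀ {i j} → Arr q S i j → P j) →
                          Acyclic q (S ∩ P) → Acyclic q S
  acyclic-if-targets-in {S} {P} p acyclic i cycle =
    acyclic i (concatMap⁺ (λ { (pi , pj , (si , sj , qij)) → [ (si , pi) , (sj , pj) , qij ] })
                          (restrict-by-targets p (last-target p cycle) cycle))

  acyclic-if-sources-in : {S P : VSet n} → (∀ {i j} → Arr q S i j → P i) →
                          Acyclic q (S ∩ P) → Acyclic q S
  acyclic-if-sources-in {S} {P} p acyclic i cycle =
    acyclic i (concatMap⁺ (λ { (pi , pj , (si , sj , qij)) → [ (si , pi) , (sj , pj) , qij ] })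
                          (restrict-by-sources p (first-source p cycle) cycle))

module _ {q : Mat n} (quiver : IsQuiver q) where

  quiver-diag : ∀ i → q i i ≡ 0ℤ
  quiver-diag i = x≡-x⇒x≡0 (quiver i i)
    where
    x≡-x⇒x≡0 : ∀ {x} → x ≡ - x → x ≡ 0ℤ
    x≡-x⇒x≡0 {+ zero}   _ = refl
    x≡-x⇒x≡0 {+ suc _}  ()
    x≡-x⇒x≡0 { -[1+ _ ]} ()

  no-loop : ∀ {i} → ¬ (0ℤ < q i i)
  no-loop {i} = ℤP.<-irrefl (sym (quiver-diag i))

  reverse-neg : ∀ {i j} → 0ℤ < q i j → q j i < 0ℤ
  reverse-neg {i} {j} qij>0 = subst (_< 0ℤ) (sym (quiver j i)) (ℤP.neg-mono-< qij>0)

  reverse-pos : ∀ {i j} → q i j < 0ℤ → 0ℤ < q j i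
  reverse-pos {i} {j} qij<0 = subst (0ℤ <_) (sym (quiver j i)) (ℤP.neg-mono-< qij<0)

  arrow⇒≢ : ∀ {i j} → 0ℤ < q i j → i ≢ j
  arrow⇒≢ qij>0 refl = no-loop qij>0

  no-2-cycle : ∀ {i j} → 0ℤ < q i j → ¬ (0ℤ < q j i)
  no-2-cycle qij>0 = ℤP.<-asym (reverse-neg qij>0)

  ∣∣-sym : ∀ i j → ∣ q j i ∣ ≡ ∣ q i j ∣
  ∣∣-sym i j = trans (cong ∣_∣ (quiver j i)) (ℤP.∣-i∣≡∣i∣ (q i j))

mutate-row : ∀ (v : Fin n) q b → mutate v q v b ≡ - q v b
mutate-row v q b with v ≟ v
... | yes _   = refl
... | no v≢v = ⊥-elim (v≢v refl)

mutate-col : ∀ (v : Fin n) q a → mutate v q a v ≡ - q a v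
mutate-col v q a with v ≟ a | v ≟ v
... | yes _ | _       = refl
... | no _  | yes _   = refl
... | no _  | no v≢v = ⊥-elim (v≢v refl)

mutate-away : ∀ {v a b : Fin n} q → v ≢ a → v ≢ b →
              mutate v q a b ≡ q a b + pos (q a v) * pos (q v b) + - (pos (q b v) * pos (q v a))
mutate-away {v = v} {a} {b} q v≢a v≢b with v ≟ a | v ≟ b
... | yes v≡a | _       = ⊥-elim (v≢a v≡a)
... | no _    | yes v≡b = ⊥-elim (v≢b v≡b)
... | no _    | no _    = refl

mutate-isQuiver : ∀ (v : Fin n) {q} → IsQuiver q → IsQuiver (mutate v q)
mutate-isQuiver v {q} quiver a b = by-cases (v ≟ a) (v ≟ b)
  where
  by-cases : Dec (v ≡ a) → Dec (v ≡ b) → mutate v q a b ≡ - mutate v q b a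
  by-cases (yes refl) _ =
    trans (mutate-row v q b) (cong -_ (trans (quiver v b) (sym (mutate-col v q b))))
  by-cases (no _) (yes refl) =
    trans (mutate-col v q a) (cong -_ (trans (quiver a v) (sym (mutate-row v q a))))
  by-cases (no v≢a) (no v≢b) = begin
    mutate v q a b                                               ≡⟨ mutate-away q v≢a v≢b ⟩
    q a b + pos (q a v) * pos (q v b) + - (pos (q b v) * pos (q v a))
      ≡⟨ cong (λ x → x + pos (q a v) * pos (q v b) + - (pos (q b v) * pos (q v a))) (quiver a b) ⟩
    - q b a + pos (q a v) * pos (q v b) + - (pos (q b v) * pos (q v a))
      ≡⟨ negate (q b a) (pos (q a v) * pos (q v b)) (pos (q b v) * pos (q v a)) ⟩
    - (q b a + pos (q b v) * pos (q v a) + - (pos (q a v) * pos (q v b)))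
      ≡⟨ cong -_ (mutate-away q v≢b v≢a) ⟨
    - mutate v q b a                                             ∎
    where
    open ≡-Reasoning
    negate : ∀ x y z → - x + y + - z ≡ - (x + z + - y)
    negate = solve-∀

-- Mutating a wing at its companion vertex

module WingMutation {w : Mat n} {k k' : Fin n}
  (w-quiver : IsQuiver w)
  (kk'-simple : ∣ w k k' ∣ ℕ.< 2)
  (paths : Qkk' w k k' ≐ (λ i → (i ≢ k) × (i ≢ k')))
  (k≢k' : k ≢ k')
  (fork-abundant : Abundant w (minus k'))
  (fork-cyclic : ¬ Acyclic w (minus k'))
  (fork-ineq : ∀ i j → minus k' i → minus k' j → w i k > + 0 → w k j > + 0 →
               (w j i > w i k) × (w j i > w k j))
  (fork-in-acyclic : Acyclic w (minus k' ∩ In w k))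
  (fork-out-acyclic : Acyclic w (minus k' ∩ Out w k))
  (rest-abundant : Abundant w (minus k))
  (rest-acyclic : Acyclic w (minus k))
  (triangle : TriangleCond w k k')
  where

  t : Mat n
  t = mutate k' w

  t-quiver : IsQuiver t
  t-quiver = mutate-isQuiver k' w-quiver

  c : ℤ
  c = w k k'

  k'≢k : k' ≢ k
  k'≢k = k≢k' ∘ sym

  Fwd Bwd : Fin n → Set
  Fwd i = 0ℤ < w k i × 0ℤ < w i k'
  Bwd i = 0ℤ < w k' i × 0ℤ < w i k

  classify : ∀ {i} → i ≢ k → i ≢ k' → Fwd i ⊎ Bwd i
  classify {i} i≢k i≢k' = proj₂ (paths i) (i≢k , i≢k')

  Fwd≢k : ∀ {i} → Fwd i → i ≢ k
  Fwd≢k (wki>0 , _) refl = no-loop w-quiver wki>0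

  Fwd≢k' : ∀ {i} → Fwd i → i ≢ k'
  Fwd≢k' (_ , wik'>0) refl = no-loop w-quiver wik'>0

  Bwd≢k : ∀ {i} → Bwd i → i ≢ k
  Bwd≢k (_ , wik>0) refl = no-loop w-quiver wik>0

  Bwd≢k' : ∀ {i} → Bwd i → i ≢ k'
  Bwd≢k' (wk'i>0 , _) refl = no-loop w-quiver wk'i>0

  Fwd∩Bwd≡∅ : ∀ {i} → Fwd i → ¬ Bwd i
  Fwd∩Bwd≡∅ (wki>0 , _) (_ , wik>0) = no-2-cycle w-quiver wki>0 wik>0

  t-row-k' : ∀ i → t k' i ≡ w i k'
  t-row-k' i = trans (mutate-row k' w i) (trans (cong -_ (w-quiver k' i)) (ℤP.neg-involutive (w i k')))

  t-col-k' : ∀ i → t i k' ≡ w k' i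
  t-col-k' i = trans (mutate-col k' w i) (trans (cong -_ (w-quiver i k')) (ℤP.neg-involutive (w k' i)))

  t-kk' : t k k' ≡ - c
  t-kk' = mutate-col k' w k

  t-k'k : t k' k ≡ c
  t-k'k = t-row-k' k

  private
    t-by-signs : ∀ {a b} → a ≢ k' → b ≢ k' → ∀ {oa ia ob ib} →
            pos (w a k') ≡ oa → pos (w k' a) ≡ ia → pos (w b k') ≡ ob → pos (w k' b) ≡ ib →
            t a b ≡ w a b + oa * ib + - (ob * ia)
    t-by-signs a≢k' b≢k' refl refl refl refl = mutate-away w (a≢k' ∘ sym) (b≢k' ∘ sym)

    pos-out-Fwd : ∀ {a} → Fwd a → pos (w a k') ≡ w a k'
    pos-out-Fwd (_ , wak'>0) = pos-pos wak'>0
    pos-in-Fwd : ∀ {a} → Fwd a → pos (w k' a) ≡ 0ℤ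
    pos-in-Fwd (_ , wak'>0) = pos-nonpos (ℤP.<⇒≤ (reverse-neg w-quiver wak'>0))
    pos-out-Bwd : ∀ {b} → Bwd b → pos (w b k') ≡ 0ℤ
    pos-out-Bwd (wk'b>0 , _) = pos-nonpos (ℤP.<⇒≤ (reverse-neg w-quiver wk'b>0))
    pos-in-Bwd : ∀ {b} → Bwd b → pos (w k' b) ≡ w k' b
    pos-in-Bwd (wk'b>0 , _) = pos-pos wk'b>0

  t-Fwd-Fwd : ∀ {a a′} → Fwd a → Fwd a′ → t a a′ ≡ w a a′
  t-Fwd-Fwd {a} {a′} fa fa′ = trans
    (t-by-signs (Fwd≢k' fa) (Fwd≢k' fa′)
                (pos-out-Fwd fa) (pos-in-Fwd fa) (pos-out-Fwd fa′) (pos-in-Fwd fa′))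
    (simplify (w a a′) (w a k') (w a′ k'))
    where
    simplify : ∀ x y z → x + y * 0ℤ + - (z * 0ℤ) ≡ x
    simplify = solve-∀

  t-Bwd-Bwd : ∀ {b b′} → Bwd b → Bwd b′ → t b b′ ≡ w b b′
  t-Bwd-Bwd {b} {b′} fb fb′ = trans
    (t-by-signs (Bwd≢k' fb) (Bwd≢k' fb′)
                (pos-out-Bwd fb) (pos-in-Bwd fb) (pos-out-Bwd fb′) (pos-in-Bwd fb′))
    (simplify (w b b′) (w k' b′) (w k' b))
    where
    simplify : ∀ x y z → x + 0ℤ * y + - (0ℤ * z) ≡ x
    simplify = solve-∀

  t-Fwd-Bwd : ∀ {a b} → Fwd a → Bwd b → t a b ≡ w a b + w a k' * w k' b
  t-Fwd-Bwd {a} {b} fa fb = trans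
    (t-by-signs (Fwd≢k' fa) (Bwd≢k' fb) (pos-out-Fwd fa) (pos-in-Fwd fa) (pos-out-Bwd fb) (pos-in-Bwd fb))
    (simplify (w a b) (w a k') (w k' b))
    where
    simplify : ∀ x y z → x + y * z + - (0ℤ * 0ℤ) ≡ x + y * z
    simplify = solve-∀

  t-k-Fwd : ∀ {a} → Fwd a → t k a ≡ w k a - w a k' * pos (- c)
  t-k-Fwd {a} fa = trans
    (t-by-signs k≢k' (Fwd≢k' fa) refl (cong pos (w-quiver k' k)) (pos-out-Fwd fa) (pos-in-Fwd fa))
    (simplify (w k a) (pos c) (w a k') (pos (- c)))
    where
    simplify : ∀ x y z u → x + y * 0ℤ + - (z * u) ≡ x - z * u
    simplify = solve-∀

  t-k-Bwd : ∀ {b} → Bwd b → t k b ≡ w k b + pos c * w k' b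
  t-k-Bwd {b} fb = trans
    (t-by-signs k≢k' (Bwd≢k' fb) refl (cong pos (w-quiver k' k)) (pos-out-Bwd fb) (pos-in-Bwd fb))
    (simplify (w k b) (pos c) (w k' b) (pos (- c)))
    where
    simplify : ∀ x y z u → x + y * z + - (0ℤ * u) ≡ x + y * z
    simplify = solve-∀

  -- Otherwise a → k' → b → a would be a cycle in W \ {k}.
  w-Fwd-Bwd : ∀ {a b} → Fwd a → Bwd b → 0ℤ < w a b
  w-Fwd-Bwd {a} {b} fa fb with 0ℤ ℤP.<? w a b
  ... | yes wab>0 = wab>0
  ... | no wab≯0  = ⊥-elim (rest-acyclic a
        ((Fwd≢k fa , k'≢k , proj₂ fa) ∷ (k'≢k , Bwd≢k fb , proj₁ fb) ∷ [ Bwd≢k fb , Fwd≢k fa , wba>0 ]))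
    where
    wab≢0 : w a b ≢ 0ℤ
    wab≢0 wab≡0 = ℕP.<⇒≱ (ℕ.s≤s ℕ.z≤n)
      (subst (λ x → 2 ℕ.≤ ∣ x ∣) wab≡0
        (rest-abundant a b (Fwd≢k fa) (Bwd≢k fb) (λ { refl → Fwd∩Bwd≡∅ fa fb })))
    wba>0 : 0ℤ < w b a
    wba>0 = reverse-pos w-quiver (ℤP.≤∧≢⇒< (ℤP.≮⇒≥ wab≯0) wab≢0)

  t-Fwd-Bwd-≥2 : ∀ {a b} → Fwd a → Bwd b → + 2 ≤ t a b
  t-Fwd-Bwd-≥2 {a} {b} fa fb = subst (+ 2 ≤_) (sym (t-Fwd-Bwd fa fb))
    (≤-+-nonneg (2≤∣x∣⇒2≤x (w-Fwd-Bwd fa fb)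
                  (rest-abundant a b (Fwd≢k fa) (Bwd≢k fb) (λ { refl → Fwd∩Bwd≡∅ fa fb })))
                (ℤP.<⇒≤ (*-pos (proj₂ fa) (proj₁ fb))))

  t-Fwd-Bwd>0 : ∀ {a b} → Fwd a → Bwd b → 0ℤ < t a b
  t-Fwd-Bwd>0 fa fb = ℤP.<-≤-trans (+<+ (ℕ.s≤s ℕ.z≤n)) (t-Fwd-Bwd-≥2 fa fb)

  -- If no arrow of the fork ended at k, all its arrows would end in Out w k,
  -- where the fork is acyclic.
  some-Bwd : Σ (Fin n) Bwd
  some-Bwd with any? (λ i → ¬? (i ≟ k') ×-dec (0ℤ ℤP.<? w i k))
  ... | yes (b , b≢k' , wbk>0) with classify (λ { refl → no-loop w-quiver wbk>0 }) b≢k'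
  ...   | inj₁ fb = ⊥-elim (no-2-cycle w-quiver (proj₁ fb) wbk>0)
  ...   | inj₂ fb = b , fb
  some-Bwd | no ∄b = ⊥-elim (fork-cyclic (acyclic-if-targets-in into-out-k fork-out-acyclic))
    where
    into-out-k : ∀ {i j} → Arr w (minus k') i j → Out w k j
    into-out-k {i} {j} (i≢k' , j≢k' , wij>0) with j ≟ k
    ... | yes refl = ⊥-elim (∄b (i , i≢k' , wij>0))
    ... | no j≢k with classify j≢k j≢k'
    ...   | inj₁ fj = proj₁ fj
    ...   | inj₂ fj = ⊥-elim (∄b (j , j≢k' , proj₂ fj))

  some-Fwd : Σ (Fin n) Fwd
  some-Fwd with any? (λ i → ¬? (i ≟ k') ×-dec (0ℤ ℤP.<? w k i))
  ... | yes (a , a≢k' , wka>0) with classify (λ { refl → no-loop w-quiver wka>0 }) a≢k'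
  ...   | inj₁ fa = a , fa
  ...   | inj₂ fa = ⊥-elim (no-2-cycle w-quiver wka>0 (proj₂ fa))
  some-Fwd | no ∄a = ⊥-elim (fork-cyclic (acyclic-if-sources-in out-of-in-k fork-in-acyclic))
    where
    out-of-in-k : ∀ {i j} → Arr w (minus k') i j → In w k i
    out-of-in-k {i} {j} (i≢k' , j≢k' , wij>0) with i ≟ k
    ... | yes refl = ⊥-elim (∄a (j , j≢k' , wij>0))
    ... | no i≢k with classify i≢k i≢k'
    ...   | inj₁ fi = ⊥-elim (∄a (i , i≢k' , proj₁ fi))
    ...   | inj₂ fi = proj₂ fi

  a₀ b₀ : Fin n
  a₀ = proj₁ some-Fwd
  b₀ = proj₁ some-Bwd

  Fwd-a₀ : Fwd a₀
  Fwd-a₀ = proj₂ some-Fwd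

  Bwd-b₀ : Bwd b₀
  Bwd-b₀ = proj₂ some-Bwd

  into-k'-Bwd : ∀ {i} → i ≢ k → 0ℤ < t i k' → Bwd i
  into-k'-Bwd {i} i≢k tik'>0 with i ≟ k'
  ... | yes refl = ⊥-elim (no-loop t-quiver tik'>0)
  ... | no i≢k' with classify i≢k i≢k'
  ...   | inj₁ fi = ⊥-elim (no-2-cycle w-quiver (proj₂ fi) (subst (0ℤ <_) (t-col-k' i) tik'>0))
  ...   | inj₂ fi = fi

  out-of-k'-Fwd : ∀ {i} → i ≢ k → 0ℤ < t k' i → Fwd i
  out-of-k'-Fwd {i} i≢k tk'i>0 with i ≟ k'
  ... | yes refl = ⊥-elim (no-loop t-quiver tk'i>0)
  ... | no i≢k' with classify i≢k i≢k'
  ...   | inj₁ fi = fi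
  ...   | inj₂ fi = ⊥-elim (no-2-cycle w-quiver (proj₁ fi) (subst (0ℤ <_) (t-row-k' i) tk'i>0))

  t-arrow⇒w-path : ∀ {i j} → i ≢ k → i ≢ k' → j ≢ k → j ≢ k' → 0ℤ < t i j →
                   TransClosure (Arr w (minus k)) i j
  t-arrow⇒w-path i≢k i≢k' j≢k j≢k' tij>0 with classify i≢k i≢k' | classify j≢k j≢k'
  ... | inj₁ fi | inj₁ fj = [ i≢k , j≢k , subst (0ℤ <_) (t-Fwd-Fwd fi fj) tij>0 ]
  ... | inj₂ fi | inj₂ fj = [ i≢k , j≢k , subst (0ℤ <_) (t-Bwd-Bwd fi fj) tij>0 ]
  ... | inj₁ fi | inj₂ fj = (i≢k , k'≢k , proj₂ fi) ∷ [ k'≢k , j≢k , proj₁ fj ]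
  ... | inj₂ fi | inj₁ fj = ⊥-elim (no-2-cycle t-quiver (t-Fwd-Bwd>0 fj fi) tij>0)

  t-abundant-away : ∀ {i j} → i ≢ k → i ≢ k' → j ≢ k → j ≢ k' → i ≢ j → 2 ℕ.≤ ∣ t i j ∣
  t-abundant-away {i} {j} i≢k i≢k' j≢k j≢k' i≢j with classify i≢k i≢k' | classify j≢k j≢k'
  ... | inj₁ fi | inj₁ fj =
    subst (λ x → 2 ℕ.≤ ∣ x ∣) (sym (t-Fwd-Fwd fi fj)) (rest-abundant i j i≢k j≢k i≢j)
  ... | inj₂ fi | inj₂ fj =
    subst (λ x → 2 ℕ.≤ ∣ x ∣) (sym (t-Bwd-Bwd fi fj)) (rest-abundant i j i≢k j≢k i≢j)
  ... | inj₁ fi | inj₂ fj = 2≤x⇒2≤∣x∣ (t-Fwd-Bwd-≥2 fi fj)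
  ... | inj₂ fi | inj₁ fj = subst (2 ℕ.≤_) (∣∣-sym t-quiver i j) (2≤x⇒2≤∣x∣ (t-Fwd-Bwd-≥2 fj fi))

  t-abundant-minus-k : Abundant t (minus k)
  t-abundant-minus-k i j i≢k j≢k i≢j with i ≟ k' | j ≟ k'
  ... | yes refl | _ = subst (2 ℕ.≤_) (sym (trans (cong ∣_∣ (t-row-k' j)) (∣∣-sym w-quiver k' j)))
                         (rest-abundant k' j i≢k j≢k i≢j)
  ... | no _ | yes refl = subst (2 ℕ.≤_) (sym (trans (cong ∣_∣ (t-col-k' i)) (∣∣-sym w-quiver i k')))
                            (rest-abundant i k' i≢k j≢k i≢j)
  ... | no i≢k' | no j≢k' = t-abundant-away i≢k i≢k' j≢k j≢k' i≢j

  t-fork-at-k' : Fork t (minus k) k'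
  t-fork-at-k' = k'≢k , t-abundant-minus-k , cyclic , return-ineq , in-acyclic , out-acyclic
    where
    cyclic : ¬ Acyclic t (minus k)
    cyclic acyclic = acyclic k'
      ((k'≢k , Fwd≢k Fwd-a₀ , subst (0ℤ <_) (sym (t-row-k' a₀)) (proj₂ Fwd-a₀))
      ∷ (Fwd≢k Fwd-a₀ , Bwd≢k Bwd-b₀ , t-Fwd-Bwd>0 Fwd-a₀ Bwd-b₀)
      ∷ [ Bwd≢k Bwd-b₀ , k'≢k , subst (0ℤ <_) (sym (t-col-k' b₀)) (proj₁ Bwd-b₀) ])
    return-ineq : ∀ i j → minus k i → minus k j → t i k' > + 0 → t k' j > + 0 →
                  (t j i > t i k') × (t j i > t k' j)
    return-ineq i j i≢k j≢k tik'>0 tk'j>0 =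
      subst₂ _<_ (sym (t-col-k' i)) (sym (t-Fwd-Bwd fj fi))
        (<-+-pos (w-Fwd-Bwd fj fi) (≤-*-pos (proj₂ fj) (ℤP.<⇒≤ (proj₁ fi)))) ,
      subst₂ _<_ (sym (t-row-k' j)) (sym (t-Fwd-Bwd fj fi))
        (<-+-pos (w-Fwd-Bwd fj fi)
           (subst (w j k' ≤_) (ℤP.*-comm (w k' i) (w j k')) (≤-*-pos (proj₁ fi) (ℤP.<⇒≤ (proj₂ fj)))))
      where
      fi = into-k'-Bwd i≢k tik'>0
      fj = out-of-k'-Fwd j≢k tk'j>0
    in-acyclic : Acyclic t (minus k ∩ In t k')
    in-acyclic = acyclic-by-arrows
      (λ { ((i≢k , ti) , (j≢k , tj) , tij>0) →
           i≢k , j≢k , subst (0ℤ <_) (t-Bwd-Bwd (into-k'-Bwd i≢k ti) (into-k'-Bwd j≢k tj)) tij>0 })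
      rest-acyclic
    out-acyclic : Acyclic t (minus k ∩ Out t k')
    out-acyclic = acyclic-by-arrows
      (λ { ((i≢k , ti) , (j≢k , tj) , tij>0) →
           i≢k , j≢k , subst (0ℤ <_) (t-Fwd-Fwd (out-of-k'-Fwd i≢k ti) (out-of-k'-Fwd j≢k tj)) tij>0 })
      rest-acyclic

  c-cases : c ≡ 0ℤ ⊎ c ≡ 1ℤ ⊎ c ≡ -1ℤ
  c-cases = cases c kk'-simple
    where
    cases : ∀ x → ∣ x ∣ ℕ.< 2 → x ≡ 0ℤ ⊎ x ≡ 1ℤ ⊎ x ≡ -1ℤ
    cases (+ zero)          _                   = inj₁ refl
    cases (+ suc zero)      _                   = inj₂ (inj₁ refl)
    cases -[1+ zero ]       _                   = inj₂ (inj₂ refl)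
    cases (+ suc (suc _))   (ℕ.s≤s (ℕ.s≤s ()))
    cases -[1+ suc _ ]      (ℕ.s≤s (ℕ.s≤s ()))

  c≡0⇒0≤c : c ≡ 0ℤ → 0ℤ ≤ c
  c≡0⇒0≤c c≡0 = ℤP.≤-reflexive (sym c≡0)

  c≡0⇒c≤0 : c ≡ 0ℤ → c ≤ 0ℤ
  c≡0⇒c≤0 = ℤP.≤-reflexive

  c≡1⇒0≤c : c ≡ 1ℤ → 0ℤ ≤ c
  c≡1⇒0≤c c≡1 = subst (0ℤ ≤_) (sym c≡1) (+≤+ ℕ.z≤n)

  c≡-1⇒c≤0 : c ≡ -1ℤ → c ≤ 0ℤ
  c≡-1⇒c≤0 c≡-1 = subst (_≤ 0ℤ) (sym c≡-1) -≤+

  t-k-Fwd-unchanged : 0ℤ ≤ c → ∀ {a} → Fwd a → t k a ≡ w k a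
  t-k-Fwd-unchanged c≥0 {a} fa = begin
    t k a                          ≡⟨ t-k-Fwd fa ⟩
    w k a - w a k' * pos (- c)     ≡⟨ cong (λ x → w k a - w a k' * x) (pos-nonpos (ℤP.neg-mono-≤ c≥0)) ⟩
    w k a - w a k' * 0ℤ            ≡⟨ cancel (w k a) (w a k') ⟩
    w k a                          ∎
    where
    open ≡-Reasoning
    cancel : ∀ x y → x - y * 0ℤ ≡ x
    cancel = solve-∀

  t-k-Bwd-unchanged : c ≤ 0ℤ → ∀ {b} → Bwd b → t k b ≡ w k b
  t-k-Bwd-unchanged c≤0 {b} fb = begin
    t k b                          ≡⟨ t-k-Bwd fb ⟩
    w k b + pos c * w k' b         ≡⟨ cong (λ x → w k b + x * w k' b) (pos-nonpos c≤0) ⟩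
    w k b + 0ℤ * w k' b            ≡⟨ cancel (w k b) (w k' b) ⟩
    w k b                          ∎
    where
    open ≡-Reasoning
    cancel : ∀ x y → x + 0ℤ * y ≡ x
    cancel = solve-∀

  t-k-Bwd-if-1 : c ≡ 1ℤ → ∀ {b} → Bwd b → t k b ≡ w k' b - w b k
  t-k-Bwd-if-1 c≡1 {b} fb = begin
    t k b                          ≡⟨ t-k-Bwd fb ⟩
    w k b + pos c * w k' b         ≡⟨ cong₂ (λ x y → x + pos y * w k' b) (w-quiver k b) c≡1 ⟩
    - w b k + 1ℤ * w k' b          ≡⟨ regroup (w b k) (w k' b) ⟩
    w k' b - w b k                 ∎
    where
    open ≡-Reasoning
    regroup : ∀ x y → - x + 1ℤ * y ≡ y - x
    regroup = solve-∀

  t-k-Fwd-if-−1 : c ≡ -1ℤ → ∀ {a} → Fwd a → t k a ≡ w k a - w a k'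
  t-k-Fwd-if-−1 c≡-1 {a} fa = begin
    t k a                          ≡⟨ t-k-Fwd fa ⟩
    w k a - w a k' * pos (- c)     ≡⟨ cong (λ x → w k a - w a k' * pos (- x)) c≡-1 ⟩
    w k a - w a k' * 1ℤ            ≡⟨ cong (λ x → w k a - x) (ℤP.*-identityʳ (w a k')) ⟩
    w k a - w a k'                 ∎
    where open ≡-Reasoning

  t-k-Fwd>0 : 0ℤ ≤ c → ∀ {a} → Fwd a → 0ℤ < t k a
  t-k-Fwd>0 c≥0 fa = subst (0ℤ <_) (sym (t-k-Fwd-unchanged c≥0 fa)) (proj₁ fa)

  t-k-Bwd<0 : c ≤ 0ℤ → ∀ {b} → Bwd b → t k b < 0ℤ
  t-k-Bwd<0 c≤0 fb = subst (_< 0ℤ) (sym (t-k-Bwd-unchanged c≤0 fb)) (reverse-neg w-quiver (proj₂ fb))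

  triangle-Bwd : c ≡ 1ℤ → ∀ {b} → Bwd b → w b k + + 2 ≤ w k' b
  triangle-Bwd c≡1 {b} fb = triangle b (w b k) (w k' b) (proj₂ fb) (proj₁ fb) (inj₂ (refl , refl , c≡1))

  triangle-Fwd : c ≡ -1ℤ → ∀ {a} → Fwd a → w k a + + 2 ≤ w a k'
  triangle-Fwd c≡-1 {a} fa = triangle a (w k a) (w a k') (proj₁ fa) (proj₂ fa)
                               (inj₁ (refl , refl , trans (w-quiver k' k) (cong -_ c≡-1)))

  t-k-Bwd≥2 : c ≡ 1ℤ → ∀ {b} → Bwd b → + 2 ≤ t k b
  t-k-Bwd≥2 c≡1 {b} fb =
    subst (+ 2 ≤_) (sym (t-k-Bwd-if-1 c≡1 fb)) (x+2≤y⇒2≤y-x {w b k} (triangle-Bwd c≡1 fb))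

  t-k-Fwd≤-2 : c ≡ -1ℤ → ∀ {a} → Fwd a → t k a ≤ - + 2
  t-k-Fwd≤-2 c≡-1 {a} fa =
    subst (_≤ - + 2) (sym (t-k-Fwd-if-−1 c≡-1 fa)) (x+2≤y⇒x-y≤-2 {w k a} (triangle-Fwd c≡-1 fa))

  into-k-Bwd : 0ℤ ≤ c → ∀ {i} → i ≢ k' → 0ℤ < t i k → Bwd i
  into-k-Bwd c≥0 {i} i≢k' tik>0 with classify (arrow⇒≢ t-quiver tik>0) i≢k'
  ... | inj₁ fi = ⊥-elim (no-2-cycle t-quiver (t-k-Fwd>0 c≥0 fi) tik>0)
  ... | inj₂ fi = fi

  out-of-k-Fwd : c ≤ 0ℤ → ∀ {i} → i ≢ k' → 0ℤ < t k i → Fwd i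
  out-of-k-Fwd c≤0 {i} i≢k' tki>0 with classify (arrow⇒≢ t-quiver tki>0 ∘ sym) i≢k'
  ... | inj₁ fi = fi
  ... | inj₂ fi = ⊥-elim (ℤP.<-asym tki>0 (t-k-Bwd<0 c≤0 fi))

  private
    c-from-k'k : ∀ {x} → t k' k ≡ x → c ≡ x
    c-from-k'k = trans (sym t-k'k)

    c-from-kk' : ∀ {x} → t k k' ≡ x → c ≡ - x
    c-from-kk' {x} e = trans (sym (ℤP.neg-involutive c)) (cong -_ (trans (sym t-kk') e))

  into-k'-≢k : 0ℤ ≤ c → ∀ {i} → 0ℤ < t i k' → i ≢ k
  into-k'-≢k c≥0 tik'>0 refl = ℤP.<⇒≱ tik'>0 (subst (_≤ 0ℤ) (sym t-kk') (ℤP.neg-mono-≤ c≥0))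

  out-of-k'-≢k : c ≤ 0ℤ → ∀ {i} → 0ℤ < t k' i → i ≢ k
  out-of-k'-≢k c≤0 tk'i>0 refl = ℤP.<⇒≱ tk'i>0 (subst (_≤ 0ℤ) (sym t-k'k) c≤0)

  no-path-k→k' : c ≤ 0ℤ → ∀ {i} → 0ℤ < t k i → ¬ (0ℤ < t i k')
  no-path-k→k' c≤0 tki>0 tik'>0 = Fwd∩Bwd≡∅ (out-of-k-Fwd c≤0 (arrow⇒≢ t-quiver tik'>0) tki>0)
                                             (into-k'-Bwd (arrow⇒≢ t-quiver tki>0 ∘ sym) tik'>0)

  no-path-k'→k : 0ℤ ≤ c → ∀ {i} → 0ℤ < t k' i → ¬ (0ℤ < t i k)
  no-path-k'→k c≥0 tk'i>0 tik>0 = Fwd∩Bwd≡∅ (out-of-k'-Fwd (arrow⇒≢ t-quiver tik>0) tk'i>0)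
                                             (into-k-Bwd c≥0 (arrow⇒≢ t-quiver tk'i>0 ∘ sym) tik>0)

  no-kk'-paths : t k' k ≡ + 0 → Qkk' t k k' ≐ Empty
  no-kk'-paths tk'k≡0 i = to , ⊥-elim
    where
    c≡0 = c-from-k'k tk'k≡0
    to : Qkk' t k k' i → Empty i
    to (inj₁ (tki>0 , tik'>0)) = no-path-k→k' (c≡0⇒c≤0 c≡0) tki>0 tik'>0
    to (inj₂ (tk'i>0 , tik>0)) = no-path-k'→k (c≡0⇒0≤c c≡0) tk'i>0 tik>0

  kk'-paths-through-in : t k' k ≡ + 1 → Qkk' t k k' ≐ In t k'
  kk'-paths-through-in tk'k≡1 i = to , from
    where
    c≡1 = c-from-k'k tk'k≡1
    to : Qkk' t k k' i → In t k' i
    to (inj₁ (_ , tik'>0))      = tik'>0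
    to (inj₂ (tk'i>0 , tik>0)) = ⊥-elim (no-path-k'→k (c≡1⇒0≤c c≡1) tk'i>0 tik>0)
    from : In t k' i → Qkk' t k k' i
    from tik'>0 = inj₁ (ℤP.<-≤-trans (+<+ (ℕ.s≤s ℕ.z≤n)) (t-k-Bwd≥2 c≡1 fi) , tik'>0)
      where
      fi = into-k'-Bwd (into-k'-≢k (c≡1⇒0≤c c≡1) tik'>0) tik'>0

  kk'-paths-through-out : t k k' ≡ + 1 → Qkk' t k k' ≐ Out t k'
  kk'-paths-through-out tkk'≡1 i = to , from
    where
    c≡-1 = c-from-kk' tkk'≡1
    to : Qkk' t k k' i → Out t k' i
    to (inj₂ (tk'i>0 , _))     = tk'i>0
    to (inj₁ (tki>0 , tik'>0)) = ⊥-elim (no-path-k→k' (c≡-1⇒c≤0 c≡-1) tki>0 tik'>0)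
    from : Out t k' i → Qkk' t k k' i
    from tk'i>0 = inj₂ (tk'i>0 , reverse-pos t-quiver (ℤP.≤-<-trans (t-k-Fwd≤-2 c≡-1 fi) -<+))
      where
      fi = out-of-k'-Fwd (out-of-k'-≢k (c≡-1⇒c≤0 c≡-1) tk'i>0) tk'i>0

  t-row-k>0 : c ≡ 1ℤ → ∀ {j} → j ≢ k → j ≢ k' → 0ℤ < t k j
  t-row-k>0 c≡1 j≢k j≢k' with classify j≢k j≢k'
  ... | inj₁ fj = t-k-Fwd>0 (c≡1⇒0≤c c≡1) fj
  ... | inj₂ fj = ℤP.<-≤-trans (+<+ (ℕ.s≤s ℕ.z≤n)) (t-k-Bwd≥2 c≡1 fj)

  t-row-k<0 : c ≡ -1ℤ → ∀ {j} → j ≢ k → j ≢ k' → t k j < 0ℤ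
  t-row-k<0 c≡-1 j≢k j≢k' with classify j≢k j≢k'
  ... | inj₁ fj = ℤP.≤-<-trans (t-k-Fwd≤-2 c≡-1 fj) -<+
  ... | inj₂ fj = t-k-Bwd<0 (c≡-1⇒c≤0 c≡-1) fj

  k-source : t k' k ≡ + 1 → Source t (minus k') k
  k-source tk'k≡1 j j≢k' tjk>0 =
    no-2-cycle t-quiver (t-row-k>0 (c-from-k'k tk'k≡1) (arrow⇒≢ t-quiver tjk>0) j≢k') tjk>0

  k-sink : t k k' ≡ + 1 → Sink t (minus k') k
  k-sink tkk'≡1 j j≢k' tkj>0 =
    ℤP.<-asym tkj>0 (t-row-k<0 (c-from-kk' tkk'≡1) (arrow⇒≢ t-quiver tkj>0 ∘ sym) j≢k')

  private
    unchanged-abundant : ∀ {j} → j ≢ k → j ≢ k' → t k j ≡ w k j → 2 ℕ.≤ ∣ t k j ∣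
    unchanged-abundant {j} j≢k j≢k' tkj≡wkj =
      subst (λ x → 2 ℕ.≤ ∣ x ∣) (sym tkj≡wkj) (fork-abundant k j k≢k' j≢k' (j≢k ∘ sym))

  t-row-k-abundant : ∀ {j} → j ≢ k → j ≢ k' → 2 ℕ.≤ ∣ t k j ∣
  t-row-k-abundant {j} j≢k j≢k' with c-cases | classify j≢k j≢k'
  ... | inj₁ c≡0        | inj₁ fj = unchanged-abundant j≢k j≢k' (t-k-Fwd-unchanged (c≡0⇒0≤c c≡0) fj)
  ... | inj₁ c≡0        | inj₂ fj = unchanged-abundant j≢k j≢k' (t-k-Bwd-unchanged (c≡0⇒c≤0 c≡0) fj)
  ... | inj₂ (inj₁ c≡1) | inj₁ fj = unchanged-abundant j≢k j≢k' (t-k-Fwd-unchanged (c≡1⇒0≤c c≡1) fj)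
  ... | inj₂ (inj₁ c≡1) | inj₂ fj = 2≤x⇒2≤∣x∣ (t-k-Bwd≥2 c≡1 fj)
  ... | inj₂ (inj₂ c≡-1) | inj₁ fj = x≤-2⇒2≤∣x∣ (t-k-Fwd≤-2 c≡-1 fj)
  ... | inj₂ (inj₂ c≡-1) | inj₂ fj = unchanged-abundant j≢k j≢k' (t-k-Bwd-unchanged (c≡-1⇒c≤0 c≡-1) fj)

  t-abundant-minus-k' : Abundant t (minus k')
  t-abundant-minus-k' i j i≢k' j≢k' i≢j with i ≟ k | j ≟ k
  ... | yes refl | _        = t-row-k-abundant (i≢j ∘ sym) j≢k'
  ... | no i≢k   | yes refl = subst (2 ℕ.≤_) (∣∣-sym t-quiver i _) (t-row-k-abundant i≢k i≢k')
  ... | no i≢k   | no j≢k   = t-abundant-away i≢k i≢k' j≢k j≢k' i≢j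

  t-acyclic-away : Acyclic t (minus k' ∩ (λ i → i ≢ k))
  t-acyclic-away = acyclic-by-paths
    (λ { ((i≢k' , i≢k) , (j≢k' , j≢k) , tij>0) → t-arrow⇒w-path i≢k i≢k' j≢k j≢k' tij>0 })
    rest-acyclic

  t-minus-k'-abundant-acyclic : t k k' ≢ + 0 → Abundant t (minus k') × Acyclic t (minus k')
  t-minus-k'-abundant-acyclic tkk'≢0 with c-cases
  ... | inj₁ c≡0 = ⊥-elim (tkk'≢0 (trans t-kk' (cong -_ c≡0)))
  ... | inj₂ (inj₁ c≡1) = t-abundant-minus-k' ,
    acyclic-if-targets-in (λ { (i≢k' , _ , tik>0) refl → k-source (trans t-k'k c≡1) _ i≢k' tik>0 })
                          t-acyclic-away
  ... | inj₂ (inj₂ c≡-1) = t-abundant-minus-k' ,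
    acyclic-if-sources-in (λ { (_ , j≢k' , tkj>0) refl → k-sink (trans t-kk' (cong -_ c≡-1)) _ j≢k' tkj>0 })
                          t-acyclic-away

  t-fork-at-k : t k k' ≡ + 0 → Fork t (minus k') k
  t-fork-at-k tkk'≡0 = k≢k' , t-abundant-minus-k' , cyclic , return-ineq , in-acyclic , out-acyclic
    where
    c≥0 = c≡0⇒0≤c (c-from-kk' tkk'≡0)
    c≤0 = c≡0⇒c≤0 (c-from-kk' tkk'≡0)
    cyclic : ¬ Acyclic t (minus k')
    cyclic acyclic = acyclic k
      ((k≢k' , Fwd≢k' Fwd-a₀ , t-k-Fwd>0 c≥0 Fwd-a₀)
      ∷ (Fwd≢k' Fwd-a₀ , Bwd≢k' Bwd-b₀ , t-Fwd-Bwd>0 Fwd-a₀ Bwd-b₀)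
      ∷ [ Bwd≢k' Bwd-b₀ , k≢k' , reverse-pos t-quiver (t-k-Bwd<0 c≤0 Bwd-b₀) ])
    return-ineq : ∀ i j → minus k' i → minus k' j → t i k > + 0 → t k j > + 0 →
                  (t j i > t i k) × (t j i > t k j)
    return-ineq i j i≢k' j≢k' tik>0 tkj>0 =
      subst₂ _<_ (sym tik≡wik) (sym (t-Fwd-Bwd fj fi)) (<-+-nonneg (proj₁ ineq) pq≥0) ,
      subst₂ _<_ (sym (t-k-Fwd-unchanged c≥0 fj)) (sym (t-Fwd-Bwd fj fi)) (<-+-nonneg (proj₂ ineq) pq≥0)
      where
      fi = into-k-Bwd c≥0 i≢k' tik>0
      fj = out-of-k-Fwd c≤0 j≢k' tkj>0
      ineq = fork-ineq i j i≢k' j≢k' (proj₂ fi) (proj₁ fj)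
      pq≥0 = ℤP.<⇒≤ (*-pos (proj₂ fj) (proj₁ fi))
      tik≡wik : t i k ≡ w i k
      tik≡wik = trans (t-quiver i k) (trans (cong -_ (t-k-Bwd-unchanged c≤0 fi)) (sym (w-quiver i k)))
    in-acyclic : Acyclic t (minus k' ∩ In t k)
    in-acyclic = acyclic-by-arrows
      (λ { ((i≢k' , tik>0) , (j≢k' , tjk>0) , tij>0) →
           let fi = into-k-Bwd c≥0 i≢k' tik>0
               fj = into-k-Bwd c≥0 j≢k' tjk>0
           in (i≢k' , proj₂ fi) , (j≢k' , proj₂ fj) , subst (0ℤ <_) (t-Bwd-Bwd fi fj) tij>0 })
      fork-in-acyclic
    out-acyclic : Acyclic t (minus k' ∩ Out t k)
    out-acyclic = acyclic-by-arrows
      (λ { ((i≢k' , tki>0) , (j≢k' , tkj>0) , tij>0) →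
           let fi = out-of-k-Fwd c≤0 i≢k' tki>0
               fj = out-of-k-Fwd c≤0 j≢k' tkj>0
           in (i≢k' , proj₁ fi) , (j≢k' , proj₁ fj) , subst (0ℤ <_) (t-Fwd-Fwd fi fj) tij>0 })
      fork-out-acyclic

  t-triangle : TriangleCond t k k'
  t-triangle i a b _ b>0 (inj₁ (tki≡a , tik'≡b , tk'k≡1)) =
    subst₂ (λ x y → x + + 2 ≤ y) (trans (sym (t-k-Bwd-if-1 c≡1 fi)) tki≡a) (trans (sym (t-col-k' i)) tik'≡b)
      (2≤x⇒y-x+2≤y (2≤∣x∣⇒2≤x (proj₂ fi) (fork-abundant i k (Bwd≢k' fi) k≢k' (Bwd≢k fi))))
    where
    c≡1 = c-from-k'k tk'k≡1
    tik'>0 = subst (0ℤ <_) (sym tik'≡b) b>0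
    fi = into-k'-Bwd (into-k'-≢k (c≡1⇒0≤c c≡1) tik'>0) tik'>0
  t-triangle i a b _ b>0 (inj₂ (tik≡a , tk'i≡b , tkk'≡1)) =
    subst₂ (λ x y → x + + 2 ≤ y) tik≡ (trans (sym (t-row-k' i)) tk'i≡b)
      (2≤x⇒y-x+2≤y (2≤∣x∣⇒2≤x (proj₁ fi) (fork-abundant k i k≢k' (Fwd≢k' fi) (Fwd≢k fi ∘ sym))))
    where
    c≡-1 = c-from-kk' tkk'≡1
    tk'i>0 = subst (0ℤ <_) (sym tk'i≡b) b>0
    fi = out-of-k'-Fwd (out-of-k'-≢k (c≡-1⇒c≤0 c≡-1) tk'i>0) tk'i>0
    negate : ∀ x y → - (x - y) ≡ y - x
    negate = solve-∀
    tik≡ : w i k' - w k i ≡ a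
    tik≡ = trans (sym (negate (w k i) (w i k'))) (trans (cong -_ (sym (t-k-Fwd-if-−1 c≡-1 fi)))
                                                        (trans (sym (t-quiver i k)) tik≡a))

  Δ : Fin n → Fin n → ℤ
  Δ i j = + ∣ t i j ∣ - + ∣ w i j ∣

  Δ-sym : ∀ i j → Δ i j ≡ Δ j i
  Δ-sym i j = cong₂ (λ x y → + x - + y) (sym (∣∣-sym t-quiver i j)) (sym (∣∣-sym w-quiver i j))

  Δ-unchanged : ∀ {i j} → t i j ≡ w i j → Δ i j ≡ 0ℤ
  Δ-unchanged {i} {j} tij≡wij =
    trans (cong (λ x → + ∣ x ∣ - + ∣ w i j ∣) tij≡wij) (ℤP.+-inverseʳ (+ ∣ w i j ∣))

  Δ-negated : ∀ {i j} → t i j ≡ - w i j → Δ i j ≡ 0ℤ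
  Δ-negated {i} {j} tij≡-wij =
    trans (cong (λ x → + x - + ∣ w i j ∣) (trans (cong ∣_∣ tij≡-wij) (ℤP.∣-i∣≡∣i∣ (w i j))))
          (ℤP.+-inverseʳ (+ ∣ w i j ∣))

  Δ-Fwd-Bwd : ∀ {a b} → Fwd a → Bwd b → Δ a b ≡ w a k' * w k' b
  Δ-Fwd-Bwd {a} {b} fa fb = begin
    + ∣ t a b ∣ - + ∣ w a b ∣            ≡⟨ cong₂ _-_ (ℤP.0≤i⇒+∣i∣≡i (ℤP.<⇒≤ (t-Fwd-Bwd>0 fa fb)))
                                                     (ℤP.0≤i⇒+∣i∣≡i (ℤP.<⇒≤ (w-Fwd-Bwd fa fb))) ⟩
    t a b - w a b                        ≡⟨ cong (_- w a b) (t-Fwd-Bwd fa fb) ⟩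
    w a b + w a k' * w k' b - w a b      ≡⟨ cancel (w a b) (w a k' * w k' b) ⟩
    w a k' * w k' b                      ∎
    where
    open ≡-Reasoning
    cancel : ∀ x y → x + y - x ≡ y
    cancel = solve-∀

  Δ-nonneg-away-k : ∀ i j → i ≢ k → j ≢ k → 0ℤ ≤ Δ i j
  Δ-nonneg-away-k i j i≢k j≢k with i ≟ k' | j ≟ k'
  ... | yes refl | _        = ℤP.≤-reflexive (sym (Δ-negated (mutate-row k' w j)))
  ... | no _     | yes refl = ℤP.≤-reflexive (sym (Δ-negated (mutate-col k' w i)))
  ... | no i≢k'  | no j≢k'  with classify i≢k i≢k' | classify j≢k j≢k'
  ...   | inj₁ fi | inj₁ fj = ℤP.≤-reflexive (sym (Δ-unchanged (t-Fwd-Fwd fi fj)))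
  ...   | inj₂ fi | inj₂ fj = ℤP.≤-reflexive (sym (Δ-unchanged (t-Bwd-Bwd fi fj)))
  ...   | inj₁ fi | inj₂ fj = subst (0ℤ ≤_) (sym (Δ-Fwd-Bwd fi fj)) (ℤP.<⇒≤ (*-pos (proj₂ fi) (proj₁ fj)))
  ...   | inj₂ fi | inj₁ fj = subst (0ℤ ≤_) (trans (sym (Δ-Fwd-Bwd fj fi)) (Δ-sym j i))
                                               (ℤP.<⇒≤ (*-pos (proj₂ fj) (proj₁ fi)))

  Δ-k-Bwd-if-1 : c ≡ 1ℤ → ∀ {b} → Bwd b → Δ k b ≡ w k' b - w b k - w b k
  Δ-k-Bwd-if-1 c≡1 {b} fb = cong₂ _-_
    (trans (ℤP.0≤i⇒+∣i∣≡i (ℤP.≤-trans (+≤+ ℕ.z≤n) (t-k-Bwd≥2 c≡1 fb))) (t-k-Bwd-if-1 c≡1 fb))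
    (trans (+∣x∣≡-x (ℤP.<⇒≤ (reverse-neg w-quiver (proj₂ fb))))
           (trans (cong -_ (w-quiver k b)) (ℤP.neg-involutive (w b k))))

  Δ-k-Fwd-if-−1 : c ≡ -1ℤ → ∀ {a} → Fwd a → Δ k a ≡ w a k' - w k a - w k a
  Δ-k-Fwd-if-−1 c≡-1 {a} fa = cong₂ _-_
    (trans (+∣x∣≡-x (ℤP.≤-trans (t-k-Fwd≤-2 c≡-1 fa) (ℤP.neg-≤-pos)))
           (trans (cong -_ (t-k-Fwd-if-−1 c≡-1 fa)) (negate (w k a) (w a k'))))
    (ℤP.0≤i⇒+∣i∣≡i (ℤP.<⇒≤ (proj₁ fa)))
    where
    negate : ∀ x y → - (x - y) ≡ y - x
    negate = solve-∀

  b₀≢a₀ : b₀ ≢ a₀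
  b₀≢a₀ b₀≡a₀ = Fwd∩Bwd≡∅ Fwd-a₀ (subst Bwd b₀≡a₀ Bwd-b₀)

  Δ-k-dominated : ∀ {v} → Δ k v ≡ 0ℤ →
                  (∀ {j} → j ≢ k → j ≢ k' → 0ℤ ≤ Δ v j + Δ k j) → ∀ j → 0ℤ ≤ Δ v j + Δ k j
  Δ-k-dominated {v} Δkv≡0 dominated j with j ≟ k | j ≟ k'
  ... | yes refl | _        = ℤP.≤-reflexive (sym (cong₂ _+_ (trans (Δ-sym v k) Δkv≡0) (Δ-unchanged diag)))
    where
    diag : t k k ≡ w k k
    diag = trans (quiver-diag t-quiver k) (sym (quiver-diag w-quiver k))
  ... | no _     | yes refl =
    ℤP.≤-reflexive (sym (cong₂ _+_ (Δ-negated (mutate-col k' w v)) (Δ-negated t-kk')))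
  ... | no j≢k   | no j≢k'  = dominated j≢k j≢k'

  Δ-total>0-via : ∀ v x → v ≢ k → x ≢ k → x ≢ v → Δ k v ≡ 0ℤ →
                  (∀ {j} → j ≢ k → j ≢ k' → 0ℤ ≤ Δ v j + Δ k j) → 0ℤ < Δ v x + Δ k x → 0ℤ < ∑∑ Δ
  Δ-total>0-via v x v≢k x≢k x≢v Δkv≡0 dominated =
    ∑∑-pos-by-merging Δ v≢k x≢k x≢v Δ-sym Δ-nonneg-away-k (Δ-k-dominated Δkv≡0 dominated)

  private
    0≤x⇒0≤x+0 : ∀ {x y} → 0ℤ ≤ x → y ≡ 0ℤ → 0ℤ ≤ x + y
    0≤x⇒0≤x+0 {x} x≥0 refl = subst (0ℤ ≤_) (sym (ℤP.+-identityʳ x)) x≥0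

    0<x⇒0<x+0 : ∀ {x y} → 0ℤ < x → y ≡ 0ℤ → 0ℤ < x + y
    0<x⇒0<x+0 {x} x>0 refl = subst (0ℤ <_) (sym (ℤP.+-identityʳ x)) x>0

  Δ-row-k-unchanged : ∀ {v j} → v ≢ k → j ≢ k → t k j ≡ w k j → 0ℤ ≤ Δ v j + Δ k j
  Δ-row-k-unchanged {v} {j} v≢k j≢k tkj≡wkj =
    0≤x⇒0≤x+0 (Δ-nonneg-away-k v j v≢k j≢k) (Δ-unchanged tkj≡wkj)

  Δ-Fwd-Bwd>0 : ∀ {a b} → Fwd a → Bwd b → 0ℤ < Δ a b
  Δ-Fwd-Bwd>0 fa fb = subst (0ℤ <_) (sym (Δ-Fwd-Bwd fa fb)) (*-pos (proj₂ fa) (proj₁ fb))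

  Δ-a+Δ-k>0-if-1 : c ≡ 1ℤ → ∀ {a b} → Fwd a → Bwd b → 0ℤ < Δ a b + Δ k b
  Δ-a+Δ-k>0-if-1 c≡1 {a} {b} fa fb =
    subst (0ℤ <_) (sym (cong₂ _+_ (Δ-Fwd-Bwd fa fb) (Δ-k-Bwd-if-1 c≡1 fb)))
      (pq+q-y-y>0 (2≤∣x∣⇒2≤x (proj₂ fa) (rest-abundant a k' (Fwd≢k fa) k'≢k (Fwd≢k' fa)))
                  (proj₂ fb) (triangle-Bwd c≡1 fb))

  Δ-b+Δ-k>0-if-−1 : c ≡ -1ℤ → ∀ {a b} → Fwd a → Bwd b → 0ℤ < Δ b a + Δ k a
  Δ-b+Δ-k>0-if-−1 c≡-1 {a} {b} fa fb =
    subst (0ℤ <_) (sym (cong₂ _+_ Δba≡ (Δ-k-Fwd-if-−1 c≡-1 fa)))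
      (pq+q-y-y>0 (2≤∣x∣⇒2≤x (proj₁ fb) (rest-abundant k' b k'≢k (Bwd≢k fb) (Bwd≢k' fb ∘ sym)))
                  (proj₁ fa) (triangle-Fwd c≡-1 fa))
    where
    Δba≡ : Δ b a ≡ w k' b * w a k'
    Δba≡ = trans (Δ-sym b a) (trans (Δ-Fwd-Bwd fa fb) (ℤP.*-comm (w a k') (w k' b)))

  Δ-total>0 : 0ℤ < ∑∑ Δ
  Δ-total>0 with c-cases
  ... | inj₁ c≡0 = Δ-total>0-via a₀ b₀ (Fwd≢k Fwd-a₀) (Bwd≢k Bwd-b₀) b₀≢a₀
    (Δ-unchanged (t-k-Fwd-unchanged c≥0 Fwd-a₀))
    (λ j≢k j≢k' → Δ-row-k-unchanged (Fwd≢k Fwd-a₀) j≢k (row-k-unchanged j≢k j≢k'))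
    (0<x⇒0<x+0 (Δ-Fwd-Bwd>0 Fwd-a₀ Bwd-b₀) (Δ-unchanged (t-k-Bwd-unchanged c≤0 Bwd-b₀)))
    where
    c≥0 = c≡0⇒0≤c c≡0
    c≤0 = c≡0⇒c≤0 c≡0
    row-k-unchanged : ∀ {j} → j ≢ k → j ≢ k' → t k j ≡ w k j
    row-k-unchanged j≢k j≢k' with classify j≢k j≢k'
    ... | inj₁ fj = t-k-Fwd-unchanged c≥0 fj
    ... | inj₂ fj = t-k-Bwd-unchanged c≤0 fj
  ... | inj₂ (inj₁ c≡1) = Δ-total>0-via a₀ b₀ (Fwd≢k Fwd-a₀) (Bwd≢k Bwd-b₀) b₀≢a₀
    (Δ-unchanged (t-k-Fwd-unchanged (c≡1⇒0≤c c≡1) Fwd-a₀))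
    dominated
    (Δ-a+Δ-k>0-if-1 c≡1 Fwd-a₀ Bwd-b₀)
    where
    dominated : ∀ {j} → j ≢ k → j ≢ k' → 0ℤ ≤ Δ a₀ j + Δ k j
    dominated {j} j≢k j≢k' with classify j≢k j≢k'
    ... | inj₁ fj = Δ-row-k-unchanged (Fwd≢k Fwd-a₀) j≢k (t-k-Fwd-unchanged (c≡1⇒0≤c c≡1) fj)
    ... | inj₂ fj = ℤP.<⇒≤ (Δ-a+Δ-k>0-if-1 c≡1 Fwd-a₀ fj)
  ... | inj₂ (inj₂ c≡-1) = Δ-total>0-via b₀ a₀ (Bwd≢k Bwd-b₀) (Fwd≢k Fwd-a₀) (b₀≢a₀ ∘ sym)
    (Δ-unchanged (t-k-Bwd-unchanged (c≡-1⇒c≤0 c≡-1) Bwd-b₀))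
    dominated
    (Δ-b+Δ-k>0-if-−1 c≡-1 Fwd-a₀ Bwd-b₀)
    where
    dominated : ∀ {j} → j ≢ k → j ≢ k' → 0ℤ ≤ Δ b₀ j + Δ k j
    dominated {j} j≢k j≢k' with classify j≢k j≢k'
    ... | inj₁ fj = ℤP.<⇒≤ (Δ-b+Δ-k>0-if-−1 c≡-1 fj Bwd-b₀)
    ... | inj₂ fj = Δ-row-k-unchanged (Bwd≢k Bwd-b₀) j≢k (t-k-Bwd-unchanged (c≡-1⇒c≤0 c≡-1) fj)

  more-arrows : numArrows w ℕ.< numArrows t
  more-arrows = numArrows-< w-quiver t-quiver Δ-total>0

  tip : Tip t k' k
  tip = t-quiver , subst (ℕ._< 2) (sym (trans (cong ∣_∣ t-kk') (ℤP.∣-i∣≡∣i∣ c))) kk'-simple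
      , t-fork-at-k' , no-kk'-paths , kk'-paths-through-in , kk'-paths-through-out , t-fork-at-k
      , t-minus-k'-abundant-acyclic , k-source , k-sink , t-triangle

corollary4p19 : ∀ {n} (W : Mat n) (k k' : Fin n) →
    Wing W k k' →
    Tip (mutate k' W) k' k × (numArrows W ℕ.< numArrows (mutate k' W))
corollary4p19 W k k'
  ( quiver , kk'-simple , paths
  , (k≢k' , fork-abundant , fork-cyclic , fork-ineq , fork-in-acyclic , fork-out-acyclic)
  , (rest-abundant , rest-acyclic) , triangle ) =
  tip , more-arrows
  where
  open WingMutation quiver kk'-simple paths k≢k' fork-abundant fork-cyclic fork-ineq
                    fork-in-acyclic fork-out-acyclic rest-abundant rest-acyclic triangle
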